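{- For every integer $n \geq 1$, $$\sum_{\pi \vdash n} t(\pi) = \sum_{i \geq 1} S(i)\,p(n-i),$$ where the left-hand sum runs over all partitions $\pi$ of $n$.
   Context: For a partition $\pi$ and an integer $i \geq 1$, let $f_i$ be the number of times $i$ appears as a part of $\pi$. The length of the initial odd-frequency chain $t(\pi)$ is the nonnegative integer $t$ such that $f_i$ is odd for all $1 \leq i \leq t$ and $f_{t+1}$ is even (so $t(\pi)=0$ if $f_1$ is even, including $f_1=0$). For an integer $m \geq 0$, $p(m)$ denotes the number of partitions of $m$ (with $p(0)=1$), and $p(m)=0$ for $m<0$. The rank of a partition is its largest part minus its number of parts. For $i \geq 1$, $S(i)$ denotes the number of partitions of $i$ into distinct parts with even rank minus the number of partitions of $i$ into distinct parts with odd rank. -}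

module Defs where

open import Data.Nat using (ℕ; zero; suc; _+_; _≤_; _≥_; _⊔_; _≟_)
open import Data.Nat.DivMod using (_%_)
open import Data.Integer as ℤ using (ℤ; +_; -_)
open import Data.Integer.Divisibility.Signed using (_∣?_)
open import Data.List using (List; []; _∷_; length; foldr; filter; map)
open import Data.Nat.ListAction using (sum)
open import Data.List.Relation.Unary.All using (All)
open import Data.List.Relation.Unary.Linked using (Linked)
open import Data.List.Relation.Unary.Unique.DecPropositional _≟_ using (unique?)
open import Data.Product using (_×_)
open import Relation.Binary.PropositionalEquality using (_≡_)
open import Relation.Nullary using (does)
open import Data.Bool using (if_then_else_)

IsPartition : ℕ → List ℕ → Set
IsPartition m xs = Linked _≥_ xs × All (1 ≤_) xs × sum xs ≡ m

freq : ℕ → List ℕ → ℕ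
freq i [] = 0
freq i (x ∷ xs) = if does (i ≟ x) then suc (freq i xs) else freq i xs

chainFrom : ℕ → ℕ → List ℕ → ℕ
chainFrom zero    i xs = 0
chainFrom (suc k) i xs =
  if does (freq i xs % 2 ≟ 1) then suc (chainFrom k (suc i) xs) else 0

-- t(π): length of the initial odd-frequency chain.  Fuel (length π + 1) is
-- enough: each i in the chain has f_i odd, hence occurs in π.
t : List ℕ → ℕ
t xs = chainFrom (suc (length xs)) 1 xs

rank : List ℕ → ℤ
rank xs = + (foldr _⊔_ 0 xs) ℤ.- + (length xs)

rankSign : List ℕ → ℤ
rankSign xs = if does (+ 2 ∣? rank xs) then + 1 else - (+ 1)

sumℤ : List ℤ → ℤ
sumℤ = foldr ℤ._+_ (+ 0)

-- Given an enumeration `parts` with  parts m  listing the partitions of m: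
-- p(m) = number of partitions of m
p : (ℕ → List (List ℕ)) → ℕ → ℕ
p parts m = length (parts m)

S : (ℕ → List (List ℕ)) → ℕ → ℤ
S parts i = sumℤ (map rankSign (filter unique? (parts i)))

-- Write c_k(n) (oddRunCount) for the number of partitions of n whose multiplicities f_1, …, f_k are all
-- odd, and d_k(n) (signCount) for the sum of (−1)^rank over the partitions of n into k distinct parts.
-- Then Σ_π t(π) = Σ_(k ≥ 1) c_k(n) and S(i) = Σ_(k ≥ 1) d_k(i). Inserting a part k gives
-- c_(k−1)(m) = c_k(k+m) + c_k(m), and removing the first column of a distinct partition gives
-- d_k(k+m) = d_(k−1)(m) − d_k(m). As c_0 = p and d_0 is the indicator of 0, induction on k and n yields
-- c_k(n) = Σ_(j ≤ n) d_k(j) p(n−j), and summing over k gives the theorem.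

module Submission where

open import Defs
open import Data.Nat as ℕ using (ℕ; zero; suc; _+_; _≤_; _<_; _≥_; _∸_; _%_; _≟_; _⊔_; z≤n; s≤s)
import Data.Nat.Properties as ℕₚ
open import Data.Nat.Induction using (<-rec)
open import Algebra.Properties.CommutativeSemigroup ℕₚ.+-commutativeSemigroup
  using () renaming (x∙yz≈y∙xz to x+[y+z]≡y+[x+z])
open import Data.Nat.Divisibility using () renaming (_∣?_ to _∣ℕ?_)
open import Relation.Binary.Properties.DecTotalOrder ℕₚ.≤-decTotalOrder using (≥-decTotalOrder)
open import Data.Bool using (Bool; true; false; not; _∧_; T; if_then_else_)
open import Data.Bool.Properties using (T?; T-∧; not-involutive)
import Data.Bool.Properties as Bool
open import Data.Empty using (⊥-elim)
open import Data.Integer as ℤ using (ℤ; +_; -[1+_])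
open import Data.Integer.Divisibility.Signed using (_∣?_)
import Data.Integer.Properties as ℤₚ
open import Algebra.Properties.AbelianGroup ℤₚ.+-0-abelianGroup using (//-rightDividesʳ)
open import Algebra.Properties.CommutativeSemigroup ℤₚ.+-commutativeSemigroup
  using () renaming (interchange to +-interchange; x∙yz≈y∙xz to x+[y+z]≡y+[x+z]ℤ)
open import Data.List using (List; []; _∷_; _++_; _∷ʳ_; [_]; length; map; filter; foldr; applyUpTo)
open import Data.List.Properties using (map-∘; map-injective; length-map; length-++; ∷ʳ-injectiveˡ)
open import Data.List.Membership.Propositional using (_∈_; _∉_)
open import Data.List.Membership.Propositional.Properties
  using (∈-filter⁺; ∈-filter⁻; ∈-map⁺; ∈-map⁻; ∈-∃++; ∈-++⁺ʳ)
open import Data.List.Membership.Propositional.Properties.WithK using (unique∧set⇒bag)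
open import Data.List.Relation.Binary.BagAndSetEquality using (∼bag⇒↭)
open import Data.List.Relation.Binary.Permutation.Propositional as ↭
  using (_↭_; ↭-sym; ↭-prep; ↭⇒↭ₛ)
open import Data.List.Relation.Binary.Permutation.Propositional.Properties
  using (All-resp-↭; shift; drop-∷; ↭-length)
open import Data.List.Relation.Binary.Pointwise using (Pointwise-≡⇒≡)
open import Data.List.Relation.Unary.All as All using (All; []; _∷_)
import Data.List.Relation.Unary.All.Properties as Allₚ
open import Data.List.Relation.Unary.Any using (here; there)
open import Data.List.Relation.Unary.AllPairs using ([]; _∷_)
open import Data.List.Relation.Unary.Linked as Linked using (Linked; []; [-]; _∷_)
import Data.List.Relation.Unary.Linked.Properties as Linkedₚ
import Data.List.Relation.Unary.Sorted.TotalOrder.Properties as Sorted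
open import Data.List.Relation.Unary.Unique.Propositional using (Unique)
import Data.List.Relation.Unary.Unique.Propositional.Properties as Unique
open import Data.List.Relation.Unary.Unique.DecPropositional _≟_ using (unique?)
open import Data.List.Membership.DecPropositional _≟_ using (_∈?_)
open import Data.List.Sort.InsertionSort.Base ≥-decTotalOrder using (insert; sort)
open import Data.List.Sort.InsertionSort.Properties ≥-decTotalOrder
  using (insert-↭; insert-↗; sort-↭; sort-↗)
open import Data.Nat.ListAction using (sum)
open import Data.Nat.ListAction.Properties using (sum-↭; sum-++)
open import Data.Product using (_×_; _,_; ∃; proj₁; proj₂)
open import Function using (_∘_; _⇔_; mk⇔; Equivalence)
open import Relation.Binary.Bundles using (DecTotalOrder)
open import Relation.Binary.PropositionalEquality hiding ([_])
open import Relation.Nullary using (Dec; does; yes; no; ¬_; _×-dec_)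
open import Relation.Nullary.Decidable
  using (isYes; isYes≗does; dec-true; dec-false; toWitness; fromWitness; toWitnessFalse; fromWitnessFalse)

-- Finite sums and convolution

∑< : ℕ → (ℕ → ℤ) → ℤ
∑< zero    f = + 0
∑< (suc n) f = f 0 ℤ.+ ∑< n (f ∘ suc)

∑<-cong : ∀ n {f g : ℕ → ℤ} → (∀ j → j < n → f j ≡ g j) → ∑< n f ≡ ∑< n g
∑<-cong zero    f≡g = refl
∑<-cong (suc n) f≡g = cong₂ ℤ._+_ (f≡g 0 (s≤s z≤n)) (∑<-cong n (λ j j<n → f≡g (suc j) (s≤s j<n)))

∑<-zero : ∀ n {f : ℕ → ℤ} → (∀ j → j < n → f j ≡ + 0) → ∑< n f ≡ + 0
∑<-zero zero    f≡0 = refl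
∑<-zero (suc n) f≡0
  rewrite f≡0 0 (s≤s z≤n) | ∑<-zero n (λ j j<n → f≡0 (suc j) (s≤s j<n)) = refl

∑<-+ : ∀ n (f g : ℕ → ℤ) → ∑< n (λ j → f j ℤ.+ g j) ≡ ∑< n f ℤ.+ ∑< n g
∑<-+ zero    f g = refl
∑<-+ (suc n) f g rewrite ∑<-+ n (f ∘ suc) (g ∘ suc) = +-interchange (f 0) (g 0) _ _

∑<-neg : ∀ n (f : ℕ → ℤ) → ℤ.- ∑< n f ≡ ∑< n (λ j → ℤ.- f j)
∑<-neg zero    f = refl
∑<-neg (suc n) f rewrite ℤₚ.neg-distrib-+ (f 0) (∑< n (f ∘ suc)) | ∑<-neg n (f ∘ suc) = refl

∑<-*ʳ : ∀ n (f : ℕ → ℤ) c → ∑< n f ℤ.* c ≡ ∑< n (λ j → f j ℤ.* c)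
∑<-*ʳ zero    f c = ℤₚ.*-zeroˡ c
∑<-*ʳ (suc n) f c rewrite ℤₚ.*-distribʳ-+ c (f 0) (∑< n (f ∘ suc)) | ∑<-*ʳ n (f ∘ suc) c = refl

∑<-++ : ∀ a b (f : ℕ → ℤ) → ∑< (a + b) f ≡ ∑< a f ℤ.+ ∑< b (λ j → f (a + j))
∑<-++ zero    b f = sym (ℤₚ.+-identityˡ _)
∑<-++ (suc a) b f rewrite ∑<-++ a b (f ∘ suc) = sym (ℤₚ.+-assoc (f 0) _ _)

∑<-comm : ∀ m n (h : ℕ → ℕ → ℤ) →
          ∑< m (λ i → ∑< n (h i)) ≡ ∑< n (λ j → ∑< m (λ i → h i j))
∑<-comm zero    n h = sym (∑<-zero n (λ _ _ → refl))
∑<-comm (suc m) n h rewrite ∑<-comm m n (h ∘ suc) = sym (∑<-+ n (h 0) _)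

∑<-truncate : ∀ {a b} (f : ℕ → ℤ) → a ≤ b → (∀ j → a ≤ j → f j ≡ + 0) → ∑< b f ≡ ∑< a f
∑<-truncate {a} {b} f a≤b tail≡0 = begin
  ∑< b f                                    ≡⟨ cong (λ c → ∑< c f) (sym (ℕₚ.m+[n∸m]≡n a≤b)) ⟩
  ∑< (a + (b ∸ a)) f                        ≡⟨ ∑<-++ a (b ∸ a) f ⟩
  ∑< a f ℤ.+ ∑< (b ∸ a) (λ j → f (a + j))
    ≡⟨ cong (ℤ._+_ (∑< a f)) (∑<-zero (b ∸ a) (λ j _ → tail≡0 (a + j) (ℕₚ.m≤m+n a j))) ⟩
  ∑< a f ℤ.+ + 0                            ≡⟨ ℤₚ.+-identityʳ _ ⟩
  ∑< a f                                    ∎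
  where open ≡-Reasoning

infix 7 [_]·_
[_]·_ : Bool → ℤ → ℤ
[ b ]· z = if b then z else + 0

[]·-split : ∀ a b z → [ a ]· z ≡ [ a ∧ not b ]· z ℤ.+ [ a ∧ b ]· z
[]·-split true  true  z = sym (ℤₚ.+-identityˡ z)
[]·-split true  false z = sym (ℤₚ.+-identityʳ z)
[]·-split false b     z = refl

[]·-false : ∀ {b} z → ¬ T b → [ b ]· z ≡ + 0
[]·-false {false} z _  = refl
[]·-false {true}  z ¬b = ⊥-elim (¬b _)

[]·-neg : ∀ {b z z′} → (T b → z′ ≡ ℤ.- z) → [ b ]· z′ ≡ ℤ.- ([ b ]· z)
[]·-neg {true}  z′≡-z = z′≡-z _
[]·-neg {false} _     = refl

∑<-select : ∀ n {k} b z → k < n → ∑< n (λ j → [ b ∧ does (k ≟ j) ]· z) ≡ [ b ]· z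
∑<-select n       false z _ = ∑<-zero n (λ _ _ → refl)
∑<-select (suc n) {zero}  true z _ = trans (cong (ℤ._+_ z) (∑<-zero n (λ _ _ → refl))) (ℤₚ.+-identityʳ z)
∑<-select (suc n) {suc k} true z (s≤s k<n) = trans (ℤₚ.+-identityˡ _) (∑<-select n true z k<n)

≡0⇒*≡0 : ∀ {a} b → a ≡ + 0 → a ℤ.* b ≡ + 0
≡0⇒*≡0 b refl = ℤₚ.*-zeroˡ b

infixl 7 _⋆_
_⋆_ : (ℕ → ℤ) → (ℕ → ℤ) → ℕ → ℤ
(d ⋆ q) n = ∑< (suc n) (λ j → d j ℤ.* q (n ∸ j))

⋆-identityˡ : ∀ d q → d 0 ≡ + 1 → (∀ j → d (suc j) ≡ + 0) → ∀ n → (d ⋆ q) n ≡ q n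
⋆-identityˡ d q d0≡1 dsuc≡0 n = begin
  d 0 ℤ.* q n ℤ.+ ∑< n (λ j → d (suc j) ℤ.* q (n ∸ suc j))
    ≡⟨ cong₂ ℤ._+_ (trans (cong (ℤ._* q n) d0≡1) (ℤₚ.*-identityˡ (q n)))
                   (∑<-zero n (λ j _ → ≡0⇒*≡0 (q (n ∸ suc j)) (dsuc≡0 j))) ⟩
  q n ℤ.+ + 0
    ≡⟨ ℤₚ.+-identityʳ (q n) ⟩
  q n ∎
  where open ≡-Reasoning

⋆-vanish : ∀ d q n → (∀ j → j ≤ n → d j ≡ + 0) → (d ⋆ q) n ≡ + 0
⋆-vanish d q n d≡0 = ∑<-zero (suc n) {λ j → d j ℤ.* q (n ∸ j)} (λ j j≤n → ≡0⇒*≡0 (q (n ∸ j)) (d≡0 j (ℕ.s≤s⁻¹ j≤n)))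

⋆-recurrence : ∀ k d d′ q → (∀ j → j < k → d j ≡ + 0) → (∀ j → d (k + j) ≡ d′ j ℤ.- d j) →
               ∀ m → (d ⋆ q) (k + m) ≡ (d′ ⋆ q) m ℤ.- (d ⋆ q) m
⋆-recurrence k d d′ q d<k≡0 d-rec m = begin
  (d ⋆ q) (k + m)
    ≡⟨ cong (λ c → ∑< c f) (sym (ℕₚ.+-suc k m)) ⟩
  ∑< (k + suc m) f
    ≡⟨ ∑<-++ k (suc m) f ⟩
  ∑< k f ℤ.+ ∑< (suc m) (λ j → f (k + j))
    ≡⟨ cong₂ ℤ._+_ (∑<-zero k {f} (λ j j<k → ≡0⇒*≡0 (q (k + m ∸ j)) (d<k≡0 j j<k)))
                   (∑<-cong (suc m) (λ j _ → shifted j)) ⟩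
  + 0 ℤ.+ ∑< (suc m) (λ j → d′ j ℤ.* q (m ∸ j) ℤ.+ ℤ.- (d j ℤ.* q (m ∸ j)))
    ≡⟨ ℤₚ.+-identityˡ _ ⟩
  ∑< (suc m) (λ j → d′ j ℤ.* q (m ∸ j) ℤ.+ ℤ.- (d j ℤ.* q (m ∸ j)))
    ≡⟨ ∑<-+ (suc m) (λ j → d′ j ℤ.* q (m ∸ j)) (λ j → ℤ.- (d j ℤ.* q (m ∸ j))) ⟩
  (d′ ⋆ q) m ℤ.+ ∑< (suc m) (λ j → ℤ.- (d j ℤ.* q (m ∸ j)))
    ≡⟨ cong (ℤ._+_ ((d′ ⋆ q) m)) (sym (∑<-neg (suc m) (λ j → d j ℤ.* q (m ∸ j)))) ⟩
  (d′ ⋆ q) m ℤ.- (d ⋆ q) m ∎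
  where
  open ≡-Reasoning
  f : ℕ → ℤ
  f j = d j ℤ.* q (k + m ∸ j)
  shifted : ∀ j → f (k + j) ≡ d′ j ℤ.* q (m ∸ j) ℤ.+ ℤ.- (d j ℤ.* q (m ∸ j))
  shifted j = begin
    d (k + j) ℤ.* q (k + m ∸ (k + j))
      ≡⟨ cong₂ ℤ._*_ (d-rec j) (cong q (ℕₚ.[m+n]∸[m+o]≡n∸o k m j)) ⟩
    (d′ j ℤ.- d j) ℤ.* q (m ∸ j)
      ≡⟨ ℤₚ.*-distribʳ-+ (q (m ∸ j)) (d′ j) (ℤ.- d j) ⟩
    d′ j ℤ.* q (m ∸ j) ℤ.+ ℤ.- d j ℤ.* q (m ∸ j)
      ≡⟨ cong (ℤ._+_ (d′ j ℤ.* q (m ∸ j))) (sym (ℤₚ.neg-distribˡ-* (d j) (q (m ∸ j)))) ⟩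
    d′ j ℤ.* q (m ∸ j) ℤ.+ ℤ.- (d j ℤ.* q (m ∸ j)) ∎

sumBy : {A : Set} → (A → ℤ) → List A → ℤ
sumBy f xs = sumℤ (map f xs)

module _ {A : Set} where

  sumBy-cong : (xs : List A) {f g : A → ℤ} → (∀ x → x ∈ xs → f x ≡ g x) → sumBy f xs ≡ sumBy g xs
  sumBy-cong []       f≡g = refl
  sumBy-cong (x ∷ xs) f≡g = cong₂ ℤ._+_ (f≡g x (here refl)) (sumBy-cong xs (λ y y∈ → f≡g y (there y∈)))

  sumBy-zero : (xs : List A) {f : A → ℤ} → (∀ x → x ∈ xs → f x ≡ + 0) → sumBy f xs ≡ + 0
  sumBy-zero []       f≡0 = refl
  sumBy-zero (x ∷ xs) f≡0 rewrite f≡0 x (here refl) | sumBy-zero xs (λ y y∈ → f≡0 y (there y∈)) = refl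

  sumBy-+ : (xs : List A) (f g : A → ℤ) → sumBy (λ x → f x ℤ.+ g x) xs ≡ sumBy f xs ℤ.+ sumBy g xs
  sumBy-+ []       f g = refl
  sumBy-+ (x ∷ xs) f g rewrite sumBy-+ xs f g = +-interchange (f x) (g x) _ _

  sumBy-neg : (xs : List A) (f : A → ℤ) → sumBy (λ x → ℤ.- f x) xs ≡ ℤ.- sumBy f xs
  sumBy-neg []       f = refl
  sumBy-neg (x ∷ xs) f rewrite sumBy-neg xs f = sym (ℤₚ.neg-distrib-+ (f x) _)

  sumBy-∑< : (xs : List A) (n : ℕ) (h : A → ℕ → ℤ) →
             sumBy (λ x → ∑< n (h x)) xs ≡ ∑< n (λ j → sumBy (λ x → h x j) xs)
  sumBy-∑< []       n h = sym (∑<-zero n (λ _ _ → refl))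
  sumBy-∑< (x ∷ xs) n h rewrite sumBy-∑< xs n h = sym (∑<-+ n (h x) _)

  sumBy-↭ : (f : A → ℤ) {xs ys : List A} → xs ↭ ys → sumBy f xs ≡ sumBy f ys
  sumBy-↭ f ↭.refl         = refl
  sumBy-↭ f (↭.prep x p)   = cong (ℤ._+_ (f x)) (sumBy-↭ f p)
  sumBy-↭ f (↭.swap x y p) rewrite sumBy-↭ f p = x+[y+z]≡y+[x+z]ℤ (f x) (f y) _
  sumBy-↭ f (↭.trans p q)  = trans (sumBy-↭ f p) (sumBy-↭ f q)

  sumBy-filter : {P : A → Set} (P? : ∀ x → Dec (P x)) (g : A → ℤ) (xs : List A) →
                 sumBy g (filter P? xs) ≡ sumBy (λ x → [ does (P? x) ]· g x) xs
  sumBy-filter P? g []       = refl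
  sumBy-filter P? g (x ∷ xs) with does (P? x)
  ... | true  = cong (ℤ._+_ (g x)) (sumBy-filter P? g xs)
  ... | false = trans (sumBy-filter P? g xs) (sym (ℤₚ.+-identityˡ _))

  sumBy-filterᵇ : (P : A → Bool) (g : A → ℤ) (xs : List A) →
                  sumBy g (filter (T? ∘ P) xs) ≡ sumBy (λ x → [ P x ]· g x) xs
  sumBy-filterᵇ P g xs =
    trans (sumBy-filter (T? ∘ P) g xs) (sumBy-cong xs (λ x _ → cong (λ b → [ b ]· g x) (does-T? (P x))))
    where
    does-T? : ∀ b → does (T? b) ≡ b
    does-T? true  = refl
    does-T? false = refl

  sumBy-split : (xs : List A) (P Q : A → Bool) (g : A → ℤ) →
    sumBy (λ x → [ P x ]· g x) xs
    ≡ sumBy (λ x → [ P x ∧ not (Q x) ]· g x) xs ℤ.+ sumBy (λ x → [ P x ∧ Q x ]· g x) xs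
  sumBy-split xs P Q g = trans (sumBy-cong xs (λ x _ → []·-split (P x) (Q x) (g x))) (sumBy-+ xs _ _)

  sumBy-1 : (xs : List A) → sumBy (λ _ → + 1) xs ≡ + length xs
  sumBy-1 []       = refl
  sumBy-1 (x ∷ xs) = cong (ℤ._+_ (+ 1)) (sumBy-1 xs)

  +-sum-map : (f : A → ℕ) (xs : List A) → + sum (map f xs) ≡ sumBy (λ x → + f x) xs
  +-sum-map f []       = refl
  +-sum-map f (x ∷ xs) = trans (ℤₚ.pos-+ (f x) _) (cong (ℤ._+_ (+ f x)) (+-sum-map f xs))

sumBy-applyUpTo : (g : ℕ → ℤ) (f : ℕ → ℕ) (n : ℕ) → sumBy g (applyUpTo f n) ≡ ∑< n (g ∘ f)
sumBy-applyUpTo g f zero    = refl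
sumBy-applyUpTo g f (suc n) = cong (ℤ._+_ (g (f 0))) (sumBy-applyUpTo g (f ∘ suc) n)

InjectiveOn : {A B : Set} → List A → (A → B) → Set
InjectiveOn xs f = ∀ {a a′} → a ∈ xs → a′ ∈ xs → f a ≡ f a′ → a ≡ a′

module _ {A B : Set} where

  Unique-map⁺ : {xs : List A} {f : A → B} → InjectiveOn xs f → Unique xs → Unique (map f xs)
  Unique-map⁺ inj []           = []
  Unique-map⁺ inj (x∉xs ∷ xs!) =
    Allₚ.map⁺ (All.tabulate (λ y∈ fx≡fy → All.lookup x∉xs y∈ (inj (here refl) (there y∈) fx≡fy)))
    ∷ Unique-map⁺ (λ a∈ a′∈ → inj (there a∈) (there a′∈)) xs!

  map-↭ : {xs : List A} {ys : List B} {f : A → B} → Unique xs → Unique ys → InjectiveOn xs f →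
          (∀ {a} → a ∈ xs → f a ∈ ys) → (∀ {b} → b ∈ ys → ∃ λ a → a ∈ xs × f a ≡ b) →
          map f xs ↭ ys
  map-↭ {f = f} xs! ys! inj into onto =
    ∼bag⇒↭ (unique∧set⇒bag (Unique-map⁺ inj xs!) ys! (mk⇔ to from))
    where
    to : ∀ {b} → b ∈ map f _ → b ∈ _
    to b∈ with _ , a∈ , refl ← ∈-map⁻ f b∈ = into a∈
    from : ∀ {b} → b ∈ _ → b ∈ map f _
    from b∈ with _ , a∈ , refl ← onto b∈ = ∈-map⁺ f a∈

  sumBy-reindex : {xs : List A} {ys : List B} → Unique xs → Unique ys →
    (P : A → Bool) (Q : B → Bool) (f : A → B) (g : B → ℤ) → InjectiveOn xs f →
    (∀ {a} → a ∈ xs → T (P a) → f a ∈ ys × T (Q (f a))) →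
    (∀ {b} → b ∈ ys → T (Q b) → ∃ λ a → (a ∈ xs × T (P a)) × f a ≡ b) →
    sumBy (λ b → [ Q b ]· g b) ys ≡ sumBy (λ a → [ P a ]· g (f a)) xs
  sumBy-reindex {xs} {ys} xs! ys! P Q f g inj into onto = begin
    sumBy (λ b → [ Q b ]· g b) ys         ≡⟨ sym (sumBy-filterᵇ Q g ys) ⟩
    sumBy g (filter (T? ∘ Q) ys)          ≡⟨ sym (sumBy-↭ g f[P-xs]↭Q-ys) ⟩
    sumBy g (map f (filter (T? ∘ P) xs))  ≡⟨ cong sumℤ (sym (map-∘ (filter (T? ∘ P) xs))) ⟩
    sumBy (g ∘ f) (filter (T? ∘ P) xs)    ≡⟨ sumBy-filterᵇ P (g ∘ f) xs ⟩
    sumBy (λ a → [ P a ]· g (f a)) xs     ∎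
    where
    open ≡-Reasoning
    in-xs : ∀ {a} → a ∈ filter (T? ∘ P) xs → a ∈ xs
    in-xs = proj₁ ∘ ∈-filter⁻ (T? ∘ P)
    into′ : ∀ {a} → a ∈ filter (T? ∘ P) xs → f a ∈ filter (T? ∘ Q) ys
    into′ a∈ with a∈xs , Pa ← ∈-filter⁻ (T? ∘ P) a∈ with fa∈ , Qfa ← into a∈xs Pa =
      ∈-filter⁺ (T? ∘ Q) fa∈ Qfa
    onto′ : ∀ {b} → b ∈ filter (T? ∘ Q) ys → ∃ λ a → a ∈ filter (T? ∘ P) xs × f a ≡ b
    onto′ b∈ with b∈ys , Qb ← ∈-filter⁻ (T? ∘ Q) b∈ with a , (a∈xs , Pa) , fa≡b ← onto b∈ys Qb =
      a , ∈-filter⁺ (T? ∘ P) a∈xs Pa , fa≡b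
    f[P-xs]↭Q-ys : map f (filter (T? ∘ P) xs) ↭ filter (T? ∘ Q) ys
    f[P-xs]↭Q-ys = map-↭ (Unique.filter⁺ (T? ∘ P) xs!) (Unique.filter⁺ (T? ∘ Q) ys!)
                         (λ a∈ a′∈ → inj (in-xs a∈) (in-xs a′∈)) into′ onto′

-- Multiplicities and runs of odd multiplicities

freq-here : ∀ x xs → freq x (x ∷ xs) ≡ suc (freq x xs)
freq-here x xs rewrite dec-true (x ≟ x) refl = refl

freq-there : ∀ {i x} xs → i ≢ x → freq i (x ∷ xs) ≡ freq i xs
freq-there {i} {x} xs i≢x rewrite dec-false (i ≟ x) i≢x = refl

freq-↭ : ∀ i {xs ys} → xs ↭ ys → freq i xs ≡ freq i ys
freq-↭ i ↭.refl         = refl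
freq-↭ i (↭.prep x p)   = cong (λ c → if does (i ≟ x) then suc c else c) (freq-↭ i p)
freq-↭ i (↭.swap x y p) rewrite freq-↭ i p with does (i ≟ x) | does (i ≟ y)
... | true  | true  = refl
... | true  | false = refl
... | false | true  = refl
... | false | false = refl
freq-↭ i (↭.trans p q)  = trans (freq-↭ i p) (freq-↭ i q)

freq≢0⇒∈ : ∀ i xs → freq i xs ≢ 0 → i ∈ xs
freq≢0⇒∈ i []       f≢0 = ⊥-elim (f≢0 refl)
freq≢0⇒∈ i (x ∷ xs) f≢0 with i ≟ x
... | yes refl = here refl
... | no  i≢x  = there (freq≢0⇒∈ i xs (f≢0 ∘ trans (freq-there xs i≢x)))

freqSum : ℕ → ℕ → List ℕ → ℕ
freqSum s zero    xs = 0
freqSum s (suc k) xs = freq s xs + freqSum (suc s) k xs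

freqSum-[] : ∀ s k → freqSum s k [] ≡ 0
freqSum-[] s zero    = refl
freqSum-[] s (suc k) = freqSum-[] (suc s) k

freqSum-below : ∀ {x s} k xs → x < s → freqSum s k (x ∷ xs) ≡ freqSum s k xs
freqSum-below         zero    xs x<s = refl
freqSum-below {x} {s} (suc k) xs x<s
  rewrite freq-there {s} xs (ℕₚ.>⇒≢ x<s) | freqSum-below k xs (ℕₚ.m<n⇒m<1+n x<s) = refl

freqSum-∷ : ∀ s k x xs → freqSum s k (x ∷ xs) ≤ suc (freqSum s k xs)
freqSum-∷ s zero    x xs = z≤n
freqSum-∷ s (suc k) x xs with s ≟ x
... | yes refl rewrite freq-here s xs | freqSum-below k xs (ℕₚ.n<1+n s) = ℕₚ.≤-refl
... | no  s≢x  rewrite freq-there xs s≢x =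
  ℕₚ.≤-trans (ℕₚ.+-monoʳ-≤ (freq s xs) (freqSum-∷ (suc s) k x xs)) (ℕₚ.≤-reflexive (ℕₚ.+-suc (freq s xs) _))

freqSum-≤-length : ∀ s k xs → freqSum s k xs ≤ length xs
freqSum-≤-length s k []       = ℕₚ.≤-reflexive (freqSum-[] s k)
freqSum-≤-length s k (x ∷ xs) = ℕₚ.≤-trans (freqSum-∷ s k x xs) (s≤s (freqSum-≤-length s k xs))

isOdd : ℕ → Bool
isOdd n = does (n % 2 ≟ 1)

isOdd-suc : ∀ n → isOdd (suc n) ≡ not (isOdd n)
isOdd-suc zero    = refl
isOdd-suc (suc n) rewrite isOdd-suc n = sym (not-involutive (isOdd n))

oddRun : ℕ → ℕ → List ℕ → Bool
oddRun i zero    π = true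
oddRun i (suc k) π = isOdd (freq i π) ∧ oddRun (suc i) k π

oddRun-suc : ∀ i k π → oddRun i (suc k) π ≡ oddRun i k π ∧ isOdd (freq (i + k) π)
oddRun-suc i zero    π rewrite ℕₚ.+-identityʳ i = Bool.∧-identityʳ _
oddRun-suc i (suc k) π rewrite oddRun-suc (suc i) k π | ℕₚ.+-suc i k = sym (Bool.∧-assoc (isOdd (freq i π)) _ _)

chainFrom-∑< : ∀ fuel i π → + chainFrom fuel i π ≡ ∑< fuel (λ j → [ oddRun i (suc j) π ]· + 1)
chainFrom-∑< zero       i π = refl
chainFrom-∑< (suc fuel) i π with isOdd (freq i π)
... | true  = cong (ℤ._+_ (+ 1)) (chainFrom-∑< fuel (suc i) π)
... | false = sym (trans (ℤₚ.+-identityˡ _) (∑<-zero fuel (λ _ _ → refl)))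

odd⇒≢0 : ∀ {n} → T (isOdd n) → n ≢ 0
odd⇒≢0 {zero}  ()
odd⇒≢0 {suc n} _ ()

oddRun⇒≤freqSum : ∀ s k π → T (oddRun s k π) → k ≤ freqSum s k π
oddRun⇒≤freqSum s zero    π _   = z≤n
oddRun⇒≤freqSum s (suc k) π run with odd , run′ ← Equivalence.to T-∧ run =
  ℕₚ.+-mono-≤ (ℕₚ.n≢0⇒n>0 (odd⇒≢0 odd)) (oddRun⇒≤freqSum (suc s) k π run′)

oddRun⇒≤length : ∀ s k π → T (oddRun s k π) → k ≤ length π
oddRun⇒≤length s k π run = ℕₚ.≤-trans (oddRun⇒≤freqSum s k π run) (freqSum-≤-length s k π)

oddRun⇒last∈ : ∀ i k π → T (oddRun i (suc k) π) → i + k ∈ π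
oddRun⇒last∈ i k π run rewrite oddRun-suc i k π =
  freq≢0⇒∈ (i + k) π (odd⇒≢0 (proj₂ (Equivalence.to T-∧ run)))

-- Partitions and the insertion of a part

Decreasing : List ℕ → Set
Decreasing = Linked _≥_

Positive : List ℕ → Set
Positive = All (1 ≤_)

Decreasing-↭⇒≡ : ∀ {xs ys} → Decreasing xs → Decreasing ys → xs ↭ ys → xs ≡ ys
Decreasing-↭⇒≡ xs↘ ys↘ xs↭ys =
  Pointwise-≡⇒≡ (Sorted.↗↭↗⇒≋ (DecTotalOrder.totalOrder ≥-decTotalOrder) xs↘ ys↘ (↭⇒↭ₛ xs↭ys))

∈⇒≤sum : ∀ {x xs} → x ∈ xs → x ≤ sum xs
∈⇒≤sum {xs = x ∷ xs} (here refl) = ℕₚ.m≤m+n x (sum xs)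
∈⇒≤sum {xs = y ∷ xs} (there x∈)  = ℕₚ.≤-trans (∈⇒≤sum x∈) (ℕₚ.m≤n+m (sum xs) y)

length≤sum : ∀ {xs} → Positive xs → length xs ≤ sum xs
length≤sum []         = z≤n
length≤sum (1≤x ∷ xs⁺) = ℕₚ.+-mono-≤ 1≤x (length≤sum xs⁺)

isPartition-0 : ∀ {π} → IsPartition 0 π → π ≡ []
isPartition-0 {[]}    _                  = refl
isPartition-0 {x ∷ π} (_ , 1≤x ∷ _ , ∑π) = ⊥-elim (ℕₚ.<⇒≢ (ℕₚ.≤-trans 1≤x (ℕₚ.m≤m+n x (sum π))) (sym ∑π))

freq-insert : ∀ i k σ → freq i (insert k σ) ≡ freq i (k ∷ σ)
freq-insert i k σ = freq-↭ i (insert-↭ k σ)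

insert-injective : ∀ k {σ τ} → Decreasing σ → Decreasing τ → insert k σ ≡ insert k τ → σ ≡ τ
insert-injective k {σ} {τ} σ↘ τ↘ eq = Decreasing-↭⇒≡ σ↘ τ↘ (drop-∷ (begin
  k ∷ σ         ↭⟨ ↭-sym (insert-↭ k σ) ⟩
  insert k σ    ≡⟨ eq ⟩
  insert k τ    ↭⟨ insert-↭ k τ ⟩
  k ∷ τ         ∎))
  where open ↭.PermutationReasoning

insert-surjective : ∀ {k π} → Decreasing π → k ∈ π → ∃ λ σ → Decreasing σ × insert k σ ≡ π
insert-surjective {k} π↘ k∈π with ys , zs , refl ← ∈-∃++ k∈π =
  sort (ys ++ zs) , sort-↗ (ys ++ zs) , Decreasing-↭⇒≡ (insert-↗ k (sort-↗ (ys ++ zs))) π↘ (begin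
    insert k (sort (ys ++ zs))  ↭⟨ insert-↭ k _ ⟩
    k ∷ sort (ys ++ zs)         ↭⟨ ↭-prep k (sort-↭ (ys ++ zs)) ⟩
    k ∷ ys ++ zs                ↭⟨ ↭-sym (shift k ys zs) ⟩
    ys ++ [ k ] ++ zs           ∎)
  where open ↭.PermutationReasoning

insert-isPartition : ∀ {k m σ} → 1 ≤ k → IsPartition m σ → IsPartition (k + m) (insert k σ)
insert-isPartition {k} {σ = σ} 1≤k (σ↘ , σ⁺ , ∑σ) =
  insert-↗ k σ↘ ,
  All-resp-↭ (↭-sym (insert-↭ k σ)) (1≤k ∷ σ⁺) ,
  trans (sum-↭ (insert-↭ k σ)) (cong (_+_ k) ∑σ)

insert-isPartition⁻ : ∀ {k m σ} → Decreasing σ → IsPartition (k + m) (insert k σ) → IsPartition m σ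
insert-isPartition⁻ {k} {σ = σ} σ↘ (_ , kσ⁺ , ∑kσ) =
  σ↘ ,
  All.tail (All-resp-↭ (insert-↭ k σ) kσ⁺) ,
  ℕₚ.+-cancelˡ-≡ k _ _ (trans (sym (sum-↭ (insert-↭ k σ))) ∑kσ)

oddRun-insert-above : ∀ i k {m} σ → i + k ≤ m → oddRun i k (insert m σ) ≡ oddRun i k σ
oddRun-insert-above i zero    σ _ = refl
oddRun-insert-above i (suc k) {m} σ i+1+k≤m =
  cong₂ _∧_ (cong isOdd (trans (freq-insert i m σ) (freq-there σ (ℕₚ.<⇒≢ i<m))))
            (oddRun-insert-above (suc i) k σ suc-i+k≤m)
  where
  suc-i+k≤m : suc i + k ≤ m
  suc-i+k≤m = subst (_≤ m) (ℕₚ.+-suc i k) i+1+k≤m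
  i<m : i < m
  i<m = ℕₚ.≤-trans (s≤s (ℕₚ.m≤m+n i k)) suc-i+k≤m

oddRun-insert-last : ∀ i k σ →
                     oddRun i (suc k) (insert (i + k) σ) ≡ oddRun i k σ ∧ not (isOdd (freq (i + k) σ))
oddRun-insert-last i k σ
  rewrite oddRun-suc i k (insert (i + k) σ) | oddRun-insert-above i k σ ℕₚ.≤-refl
        | freq-insert (i + k) (i + k) σ | freq-here (i + k) σ | isOdd-suc (freq (i + k) σ) = refl

-- Adding a column to a Ferrers diagram

maxPart : List ℕ → ℕ
maxPart = foldr _⊔_ 0

maxPart-map-suc : ∀ x xs → maxPart (map suc (x ∷ xs)) ≡ suc (maxPart (x ∷ xs))
maxPart-map-suc x []       = cong suc (sym (ℕₚ.⊔-identityʳ x))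
maxPart-map-suc x (y ∷ ys) rewrite maxPart-map-suc y ys = refl

maxPart-map-suc-∷ʳ1 : ∀ xs → maxPart (map suc xs ∷ʳ 1) ≡ suc (maxPart xs)
maxPart-map-suc-∷ʳ1 []       = refl
maxPart-map-suc-∷ʳ1 (x ∷ xs) rewrite maxPart-map-suc-∷ʳ1 xs = refl

length-∷ʳ : ∀ {A : Set} (xs : List A) x → length (xs ∷ʳ x) ≡ suc (length xs)
length-∷ʳ xs x = trans (length-++ xs) (ℕₚ.+-comm (length xs) 1)

sum-∷ʳ : ∀ xs x → sum (xs ∷ʳ x) ≡ sum xs + x
sum-∷ʳ xs x = trans (sum-++ xs [ x ]) (cong (_+_ (sum xs)) (ℕₚ.+-identityʳ x))

sum-map-suc : ∀ xs → sum (map suc xs) ≡ length xs + sum xs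
sum-map-suc []       = refl
sum-map-suc (x ∷ xs) = cong suc (trans (cong (_+_ x) (sum-map-suc xs)) (x+[y+z]≡y+[x+z] x (length xs) (sum xs)))

even-suc : ∀ n → does (2 ∣ℕ? suc n) ≡ not (does (2 ∣ℕ? n))
even-suc zero    = refl
even-suc (suc n) rewrite even-suc n = sym (not-involutive _)

negOnePow : ℤ → ℤ
negOnePow z = if does (+ 2 ∣? z) then + 1 else ℤ.- + 1

negOnePow-suc : ∀ z → negOnePow (+ 1 ℤ.+ z) ≡ ℤ.- negOnePow z
negOnePow-suc (+ n) rewrite even-suc n with does (2 ∣ℕ? n)
... | true  = refl
... | false = refl
negOnePow-suc -[1+ zero ]  = refl
negOnePow-suc -[1+ suc n ] rewrite even-suc (suc n) with does (2 ∣ℕ? suc n)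
... | true  = refl
... | false = refl

rankSign-map-suc : ∀ x xs → rankSign (map suc (x ∷ xs)) ≡ ℤ.- rankSign (x ∷ xs)
rankSign-map-suc x xs = trans (cong negOnePow rank-suc) (negOnePow-suc (rank (x ∷ xs)))
  where
  rank-suc : rank (map suc (x ∷ xs)) ≡ + 1 ℤ.+ rank (x ∷ xs)
  rank-suc = trans (cong₂ (λ a b → + a ℤ.- + b) (maxPart-map-suc x xs) (length-map suc (x ∷ xs)))
                   (ℤₚ.+-assoc (+ 1) (+ maxPart (x ∷ xs)) (ℤ.- + length (x ∷ xs)))

rankSign-map-suc-∷ʳ1 : ∀ xs → rankSign (map suc xs ∷ʳ 1) ≡ rankSign xs
rankSign-map-suc-∷ʳ1 xs = cong negOnePow (begin
  + maxPart (map suc xs ∷ʳ 1) ℤ.- + length (map suc xs ∷ʳ 1)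
    ≡⟨ cong₂ (λ a b → + a ℤ.- + b) (maxPart-map-suc-∷ʳ1 xs)
             (trans (length-∷ʳ (map suc xs) 1) (cong suc (length-map suc xs))) ⟩
  + suc (maxPart xs) ℤ.- + suc (length xs)
    ≡⟨ ℤₚ.m-n≡m⊖n (suc (maxPart xs)) (suc (length xs)) ⟩
  suc (maxPart xs) ℤ.⊖ suc (length xs)
    ≡⟨ ℤₚ.[1+m]⊖[1+n]≡m⊖n (maxPart xs) (length xs) ⟩
  maxPart xs ℤ.⊖ length xs
    ≡⟨ sym (ℤₚ.m-n≡m⊖n (maxPart xs) (length xs)) ⟩
  + maxPart xs ℤ.- + length xs ∎)
  where open ≡-Reasoning

Decreasing-map-suc : ∀ {xs} → Decreasing xs → Decreasing (map suc xs)
Decreasing-map-suc = Linkedₚ.map⁺ ∘ Linked.map s≤s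

Decreasing-map-suc⁻ : ∀ {xs} → Decreasing (map suc xs) → Decreasing xs
Decreasing-map-suc⁻ = Linked.map ℕ.s≤s⁻¹ ∘ Linkedₚ.map⁻

Decreasing-∷ʳ : ∀ {xs y} → Decreasing xs → All (y ≤_) xs → Decreasing (xs ∷ʳ y)
Decreasing-∷ʳ []           []         = [-]
Decreasing-∷ʳ [-]          (y≤x ∷ []) = y≤x ∷ [-]
Decreasing-∷ʳ (x≥x′ ∷ xs↘) (_ ∷ y≤xs) = x≥x′ ∷ Decreasing-∷ʳ xs↘ y≤xs

Decreasing-∷ʳ⁻ : ∀ xs {y} → Decreasing (xs ∷ʳ y) → Decreasing xs
Decreasing-∷ʳ⁻ []            _            = []
Decreasing-∷ʳ⁻ (x ∷ [])      _            = [-]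
Decreasing-∷ʳ⁻ (x ∷ x′ ∷ xs) (x≥x′ ∷ xs↘) = x≥x′ ∷ Decreasing-∷ʳ⁻ (x′ ∷ xs) xs↘

Unique-∷ʳ⁻ : ∀ {A : Set} (xs : List A) {y} → Unique (xs ∷ʳ y) → Unique xs
Unique-∷ʳ⁻ []       _          = []
Unique-∷ʳ⁻ (x ∷ xs) (x∉ ∷ xs!) = Allₚ.++⁻ˡ xs x∉ ∷ Unique-∷ʳ⁻ xs xs!

Positive-map-suc : ∀ xs → Positive (map suc xs)
Positive-map-suc []       = []
Positive-map-suc (x ∷ xs) = s≤s z≤n ∷ Positive-map-suc xs

1∉map-suc : ∀ {xs} → Positive xs → 1 ∉ map suc xs
1∉map-suc xs⁺ 1∈ with x , x∈ , refl ← ∈-map⁻ suc 1∈ = ℕₚ.<-irrefl refl (All.lookup xs⁺ x∈)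

Unique-map-suc-∷ʳ1 : ∀ {μ} → Positive μ → Unique μ → Unique (map suc μ ∷ʳ 1)
Unique-map-suc-∷ʳ1 μ⁺ μ! =
  Unique.++⁺ (Unique.map⁺ ℕₚ.suc-injective μ!) ([] ∷ []) (λ { (1∈ , here refl) → 1∉map-suc μ⁺ 1∈ })

isPartition-map-suc : ∀ {k m μ} → length μ ≡ k → IsPartition m μ → IsPartition (k + m) (map suc μ)
isPartition-map-suc {μ = μ} refl (μ↘ , _ , ∑μ) =
  Decreasing-map-suc μ↘ , Positive-map-suc μ , trans (sum-map-suc μ) (cong (_+_ (length μ)) ∑μ)

isPartition-map-suc⁻ : ∀ {k m μ} → Positive μ → length μ ≡ k → IsPartition (k + m) (map suc μ) → IsPartition m μ
isPartition-map-suc⁻ {μ = μ} μ⁺ refl (sμ↘ , _ , ∑sμ) =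
  Decreasing-map-suc⁻ sμ↘ , μ⁺ , ℕₚ.+-cancelˡ-≡ (length μ) _ _ (trans (sym (sum-map-suc μ)) ∑sμ)

isPartition-map-suc-∷ʳ1 : ∀ {k m μ} → length μ ≡ k → IsPartition m μ →
                          IsPartition (suc (k + m)) (map suc μ ∷ʳ 1)
isPartition-map-suc-∷ʳ1 {μ = μ} len μ-part@(μ↘ , _ , _) with _ , _ , ∑sμ ← isPartition-map-suc len μ-part =
  Decreasing-∷ʳ (Decreasing-map-suc μ↘) (Positive-map-suc μ) ,
  Allₚ.++⁺ (Positive-map-suc μ) (s≤s z≤n ∷ []) ,
  trans (sum-∷ʳ (map suc μ) 1) (trans (ℕₚ.+-comm _ 1) (cong suc ∑sμ))

isPartition-map-suc-∷ʳ1⁻ : ∀ {k m μ} → Positive μ → length μ ≡ k →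
                           IsPartition (suc (k + m)) (map suc μ ∷ʳ 1) → IsPartition m μ
isPartition-map-suc-∷ʳ1⁻ {μ = μ} μ⁺ len (l↘ , _ , ∑l) = isPartition-map-suc⁻ μ⁺ len
  (Decreasing-∷ʳ⁻ (map suc μ) l↘ , Positive-map-suc μ ,
   ℕₚ.suc-injective (trans (trans (ℕₚ.+-comm 1 _) (sym (sum-∷ʳ (map suc μ) 1))) ∑l))

no-1⇒map-suc : ∀ {l} → Positive l → 1 ∉ l → ∃ λ μ → Positive μ × l ≡ map suc μ
no-1⇒map-suc {[]}              []       _  = [] , [] , refl
no-1⇒map-suc {zero ∷ l}        (() ∷ _) _
no-1⇒map-suc {suc zero ∷ l}    _        1∉ = ⊥-elim (1∉ (here refl))
no-1⇒map-suc {suc (suc x) ∷ l} (_ ∷ l⁺) 1∉ with μ , μ⁺ , refl ← no-1⇒map-suc l⁺ (1∉ ∘ there) =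
  suc x ∷ μ , s≤s z≤n ∷ μ⁺ , refl

has-1⇒map-suc-∷ʳ1 : ∀ {l} → Decreasing l → Positive l → Unique l → 1 ∈ l →
                     ∃ λ μ → Positive μ × l ≡ map suc μ ∷ʳ 1
has-1⇒map-suc-∷ʳ1 {zero ∷ l}           _          (() ∷ _)       _            _
has-1⇒map-suc-∷ʳ1 {suc zero ∷ []}      _          _              _            _ = [] , [] , refl
has-1⇒map-suc-∷ʳ1 {suc zero ∷ y ∷ l}   (y≤1 ∷ _) (_ ∷ 1≤y ∷ _)  ((1≢y ∷ _) ∷ _) _ =
  ⊥-elim (1≢y (ℕₚ.≤-antisym 1≤y y≤1))
has-1⇒map-suc-∷ʳ1 {suc (suc x) ∷ l}    l↘         (_ ∷ l⁺)       (_ ∷ l!)      (there 1∈)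
  with μ , μ⁺ , refl ← has-1⇒map-suc-∷ʳ1 (Linked.tail l↘) l⁺ l! 1∈ = suc x ∷ μ , s≤s z≤n ∷ μ⁺ , refl

distinctOfLength : ℕ → List ℕ → Bool
distinctOfLength k l = isYes (unique? l ×-dec (length l ≟ k))

distinctOfLength⁺ : ∀ {k l} → Unique l → length l ≡ k → T (distinctOfLength k l)
distinctOfLength⁺ {k} {l} l! len = fromWitness {a? = unique? l ×-dec (length l ≟ k)} (l! , len)

distinctOfLength⁻ : ∀ k l → T (distinctOfLength k l) → Unique l × length l ≡ k
distinctOfLength⁻ k l = toWitness {a? = unique? l ×-dec (length l ≟ k)}

module Counting (parts : ℕ → List (List ℕ)) (parts! : ∀ m → Unique (parts m))
                (∈parts⇔ : ∀ m π → (π ∈ parts m) ⇔ IsPartition m π) where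

  isPartition : ∀ {m π} → π ∈ parts m → IsPartition m π
  isPartition {m} {π} = Equivalence.to (∈parts⇔ m π)

  ∈parts : ∀ {m π} → IsPartition m π → π ∈ parts m
  ∈parts {m} {π} = Equivalence.from (∈parts⇔ m π)

  pℤ : ℕ → ℤ
  pℤ m = + p parts m

  p-0 : p parts 0 ≡ 1
  p-0 = trans (sym (length-map (λ π → π) (parts 0)))
              (↭-length (map-↭ (parts! 0) ([] ∷ []) (λ _ _ eq → eq) into onto))
    where
    into : ∀ {π} → π ∈ parts 0 → π ∈ [ [] ]
    into π∈ = here (isPartition-0 (isPartition π∈))
    onto : ∀ {π} → π ∈ [ [] ] → ∃ λ σ → σ ∈ parts 0 × σ ≡ π
    onto (here refl) = [] , ∈parts ([] , [] , refl) , refl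

  oddRunCount : ℕ → ℕ → ℤ
  oddRunCount k n = sumBy (λ π → [ oddRun 1 k π ]· + 1) (parts n)

  oddRunCount-0 : ∀ n → oddRunCount 0 n ≡ pℤ n
  oddRunCount-0 n = sumBy-1 (parts n)

  oddRunCount-vanish : ∀ {k n} → n < k → oddRunCount k n ≡ + 0
  oddRunCount-vanish {suc k} {n} n<k = sumBy-zero (parts n) λ π π∈ → []·-false (+ 1) λ run →
    ℕₚ.<⇒≱ n<k (subst (suc k ≤_) (proj₂ (proj₂ (isPartition π∈))) (∈⇒≤sum (oddRun⇒last∈ 1 k π run)))

  -- Inserting a part k+1 is a bijection from the partitions of m with f_1, …, f_k odd and f_(k+1) even
  -- onto the partitions of k+1+m with f_1, …, f_(k+1) odd.
  oddRunCount-insert : ∀ k m → oddRunCount (suc k) (suc k + m)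
                     ≡ sumBy (λ σ → [ oddRun 1 k σ ∧ not (isOdd (freq (suc k) σ)) ]· + 1) (parts m)
  oddRunCount-insert k m =
    sumBy-reindex (parts! m) (parts! (suc k + m)) _ (oddRun 1 (suc k)) (insert (suc k)) (λ _ → + 1)
      (λ σ∈ τ∈ → insert-injective (suc k) (proj₁ (isPartition σ∈)) (proj₁ (isPartition τ∈))) into onto
    where
    into : ∀ {σ} → σ ∈ parts m → T (oddRun 1 k σ ∧ not (isOdd (freq (suc k) σ))) →
           insert (suc k) σ ∈ parts (suc k + m) × T (oddRun 1 (suc k) (insert (suc k) σ))
    into {σ} σ∈ run = ∈parts (insert-isPartition (s≤s z≤n) (isPartition σ∈)) ,
                      subst T (sym (oddRun-insert-last 1 k σ)) run
    onto : ∀ {π} → π ∈ parts (suc k + m) → T (oddRun 1 (suc k) π) →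
           ∃ λ σ → (σ ∈ parts m × T (oddRun 1 k σ ∧ not (isOdd (freq (suc k) σ)))) × insert (suc k) σ ≡ π
    onto {π} π∈ run with σ , σ↘ , refl ← insert-surjective (proj₁ (isPartition π∈)) (oddRun⇒last∈ 1 k π run) =
      σ , (∈parts (insert-isPartition⁻ σ↘ (isPartition π∈)) , subst T (oddRun-insert-last 1 k σ) run) , refl

  oddRunCount-recurrence : ∀ k m →
                           oddRunCount (suc k) (suc k + m) ≡ oddRunCount k m ℤ.- oddRunCount (suc k) m
  oddRunCount-recurrence k m = a≡b+c⇒b≡a-c (begin
    oddRunCount k m
      ≡⟨ sumBy-split (parts m) (oddRun 1 k) (isOdd ∘ freq (suc k)) (λ _ → + 1) ⟩
    sumBy (λ σ → [ oddRun 1 k σ ∧ not (isOdd (freq (suc k) σ)) ]· + 1) (parts m) ℤ.+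
    sumBy (λ σ → [ oddRun 1 k σ ∧ isOdd (freq (suc k) σ) ]· + 1) (parts m)
      ≡⟨ cong₂ ℤ._+_ (sym (oddRunCount-insert k m))
                     (sumBy-cong (parts m) (λ σ _ → cong (λ b → [ b ]· + 1) (sym (oddRun-suc 1 k σ)))) ⟩
    oddRunCount (suc k) (suc k + m) ℤ.+ oddRunCount (suc k) m ∎)
    where
    open ≡-Reasoning
    a≡b+c⇒b≡a-c : ∀ {a b c} → a ≡ b ℤ.+ c → b ≡ a ℤ.- c
    a≡b+c⇒b≡a-c {c = c} refl = sym (//-rightDividesʳ c _)

  signCount : ℕ → ℕ → ℤ
  signCount k n = sumBy (λ l → [ distinctOfLength k l ]· rankSign l) (parts n)

  signCount-vanish : ∀ {k n} → n < k → signCount k n ≡ + 0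
  signCount-vanish {k} {n} n<k = sumBy-zero (parts n) λ l l∈ → []·-false (rankSign l) λ dist →
    let _ , l⁺ , ∑l = isPartition l∈ in
    ℕₚ.<⇒≱ n<k (subst₂ _≤_ (proj₂ (distinctOfLength⁻ k l dist)) ∑l (length≤sum l⁺))

  signCount-0-0 : signCount 0 0 ≡ + 1
  signCount-0-0 = begin
    signCount 0 0
      ≡⟨ sumBy-cong (parts 0) (λ l l∈ → cong (λ l → [ distinctOfLength 0 l ]· rankSign l)
                                             (isPartition-0 (isPartition l∈))) ⟩
    sumBy (λ _ → + 1) (parts 0)  ≡⟨ sumBy-1 (parts 0) ⟩
    pℤ 0                         ≡⟨ cong +_ p-0 ⟩
    + 1                          ∎
    where open ≡-Reasoning

  signCount-0-suc : ∀ n → signCount 0 (suc n) ≡ + 0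
  signCount-0-suc n = sumBy-zero (parts (suc n)) λ l l∈ → []·-false (rankSign l) λ dist →
    no-parts {l} (proj₂ (distinctOfLength⁻ 0 l dist)) (proj₂ (proj₂ (isPartition l∈)))
    where
    no-parts : ∀ {l} → length l ≡ 0 → sum l ≢ suc n
    no-parts {[]} _ ()

  -- Removing the first column of a partition into k+1 distinct parts leaves a partition into distinct
  -- parts: into k+1 of them, with rank one less, if 1 is not a part; into k of them, with the same rank,
  -- if 1 is a part.
  signCount-map-suc : ∀ k m →
    sumBy (λ l → [ distinctOfLength (suc k) l ∧ not (isYes (1 ∈? l)) ]· rankSign l) (parts (suc k + m))
    ≡ ℤ.- signCount (suc k) m
  signCount-map-suc k m = begin
    sumBy (λ l → [ distinctOfLength (suc k) l ∧ not (isYes (1 ∈? l)) ]· rankSign l) (parts (suc k + m))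
      ≡⟨ sumBy-reindex (parts! m) (parts! (suc k + m)) _ _ (map suc) rankSign
                       (λ _ _ → map-injective ℕₚ.suc-injective) into onto ⟩
    sumBy (λ μ → [ distinctOfLength (suc k) μ ]· rankSign (map suc μ)) (parts m)
      ≡⟨ sumBy-cong (parts m) (λ μ _ → flip μ) ⟩
    sumBy (λ μ → ℤ.- ([ distinctOfLength (suc k) μ ]· rankSign μ)) (parts m)
      ≡⟨ sumBy-neg (parts m) _ ⟩
    ℤ.- signCount (suc k) m ∎
    where
    open ≡-Reasoning
    into : ∀ {μ} → μ ∈ parts m → T (distinctOfLength (suc k) μ) → map suc μ ∈ parts (suc k + m) ×
           T (distinctOfLength (suc k) (map suc μ) ∧ not (isYes (1 ∈? map suc μ)))
    into {μ} μ∈ dist with μ! , len ← distinctOfLength⁻ (suc k) μ dist with μ-part@(_ , μ⁺ , _) ← isPartition μ∈ =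
      ∈parts (isPartition-map-suc len μ-part) ,
      Equivalence.from T-∧ (distinctOfLength⁺ (Unique.map⁺ ℕₚ.suc-injective μ!) (trans (length-map suc μ) len) ,
                            fromWitnessFalse {a? = 1 ∈? map suc μ} (1∉map-suc μ⁺))
    onto : ∀ {l} → l ∈ parts (suc k + m) → T (distinctOfLength (suc k) l ∧ not (isYes (1 ∈? l))) →
           ∃ λ μ → (μ ∈ parts m × T (distinctOfLength (suc k) μ)) × map suc μ ≡ l
    onto {l} l∈ dist-no-1 with dist , no-1 ← Equivalence.to T-∧ dist-no-1 with l! , len ← distinctOfLength⁻ (suc k) l dist
      with μ , μ⁺ , refl ← no-1⇒map-suc (proj₁ (proj₂ (isPartition l∈))) (toWitnessFalse {a? = 1 ∈? l} no-1) =
      μ , (∈parts (isPartition-map-suc⁻ μ⁺ len′ (isPartition l∈)) , distinctOfLength⁺ (Unique.map⁻ l!) len′) , refl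
      where
      len′ : length μ ≡ suc k
      len′ = trans (sym (length-map suc μ)) len
    flip : ∀ μ → [ distinctOfLength (suc k) μ ]· rankSign (map suc μ)
                 ≡ ℤ.- ([ distinctOfLength (suc k) μ ]· rankSign μ)
    flip []       = refl
    flip (x ∷ xs) = []·-neg {distinctOfLength (suc k) (x ∷ xs)} (λ _ → rankSign-map-suc x xs)

  signCount-map-suc-∷ʳ1 : ∀ k m →
    sumBy (λ l → [ distinctOfLength (suc k) l ∧ isYes (1 ∈? l) ]· rankSign l) (parts (suc k + m))
    ≡ signCount k m
  signCount-map-suc-∷ʳ1 k m = begin
    sumBy (λ l → [ distinctOfLength (suc k) l ∧ isYes (1 ∈? l) ]· rankSign l) (parts (suc k + m))
      ≡⟨ sumBy-reindex (parts! m) (parts! (suc k + m)) _ _ (λ μ → map suc μ ∷ʳ 1) rankSign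
           (λ _ _ eq → map-injective ℕₚ.suc-injective (∷ʳ-injectiveˡ (map suc _) (map suc _) eq)) into onto ⟩
    sumBy (λ μ → [ distinctOfLength k μ ]· rankSign (map suc μ ∷ʳ 1)) (parts m)
      ≡⟨ sumBy-cong (parts m) (λ μ _ → cong ([ distinctOfLength k μ ]·_) (rankSign-map-suc-∷ʳ1 μ)) ⟩
    signCount k m ∎
    where
    open ≡-Reasoning
    into : ∀ {μ} → μ ∈ parts m → T (distinctOfLength k μ) → map suc μ ∷ʳ 1 ∈ parts (suc k + m) ×
           T (distinctOfLength (suc k) (map suc μ ∷ʳ 1) ∧ isYes (1 ∈? map suc μ ∷ʳ 1))
    into {μ} μ∈ dist with μ! , len ← distinctOfLength⁻ k μ dist with μ-part@(_ , μ⁺ , _) ← isPartition μ∈ =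
      ∈parts (isPartition-map-suc-∷ʳ1 len μ-part) ,
      Equivalence.from T-∧
        (distinctOfLength⁺ (Unique-map-suc-∷ʳ1 μ⁺ μ!)
                           (trans (length-∷ʳ (map suc μ) 1) (cong suc (trans (length-map suc μ) len))) ,
         fromWitness {a? = 1 ∈? map suc μ ∷ʳ 1} (∈-++⁺ʳ (map suc μ) (here refl)))
    onto : ∀ {l} → l ∈ parts (suc k + m) → T (distinctOfLength (suc k) l ∧ isYes (1 ∈? l)) →
           ∃ λ μ → (μ ∈ parts m × T (distinctOfLength k μ)) × map suc μ ∷ʳ 1 ≡ l
    onto {l} l∈ dist-1 with dist , has-1 ← Equivalence.to T-∧ dist-1 with l! , len ← distinctOfLength⁻ (suc k) l dist
      with l↘ , l⁺ , _ ← isPartition l∈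
      with μ , μ⁺ , refl ← has-1⇒map-suc-∷ʳ1 l↘ l⁺ l! (toWitness {a? = 1 ∈? l} has-1) =
      μ , (∈parts (isPartition-map-suc-∷ʳ1⁻ μ⁺ len′ (isPartition l∈)) ,
           distinctOfLength⁺ (Unique.map⁻ (Unique-∷ʳ⁻ (map suc μ) l!)) len′) , refl
      where
      len′ : length μ ≡ k
      len′ = ℕₚ.suc-injective (trans (cong suc (sym (length-map suc μ))) (trans (sym (length-∷ʳ (map suc μ) 1)) len))

  signCount-recurrence : ∀ k m → signCount (suc k) (suc k + m) ≡ signCount k m ℤ.- signCount (suc k) m
  signCount-recurrence k m = begin
    signCount (suc k) (suc k + m)
      ≡⟨ sumBy-split (parts (suc k + m)) (distinctOfLength (suc k)) (λ l → isYes (1 ∈? l)) rankSign ⟩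
    sumBy (λ l → [ distinctOfLength (suc k) l ∧ not (isYes (1 ∈? l)) ]· rankSign l) (parts (suc k + m)) ℤ.+
    sumBy (λ l → [ distinctOfLength (suc k) l ∧ isYes (1 ∈? l) ]· rankSign l) (parts (suc k + m))
      ≡⟨ cong₂ ℤ._+_ (signCount-map-suc k m) (signCount-map-suc-∷ʳ1 k m) ⟩
    ℤ.- signCount (suc k) m ℤ.+ signCount k m
      ≡⟨ ℤₚ.+-comm (ℤ.- signCount (suc k) m) (signCount k m) ⟩
    signCount k m ℤ.- signCount (suc k) m ∎
    where open ≡-Reasoning

  S≡∑signCount : ∀ {n} i → i < n → S parts (suc i) ≡ ∑< n (λ j → signCount (suc j) (suc i))
  S≡∑signCount {n} i i<n = begin
    S parts (suc i)
      ≡⟨ sumBy-filter unique? rankSign (parts (suc i)) ⟩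
    sumBy (λ l → [ does (unique? l) ]· rankSign l) (parts (suc i))
      ≡⟨ sumBy-cong (parts (suc i)) (λ l l∈ → sym (by-length l (isPartition l∈))) ⟩
    sumBy (λ l → ∑< n (λ j → [ distinctOfLength (suc j) l ]· rankSign l)) (parts (suc i))
      ≡⟨ sumBy-∑< (parts (suc i)) n (λ l j → [ distinctOfLength (suc j) l ]· rankSign l) ⟩
    ∑< n (λ j → signCount (suc j) (suc i)) ∎
    where
    open ≡-Reasoning
    by-length : ∀ l → IsPartition (suc i) l →
                ∑< n (λ j → [ distinctOfLength (suc j) l ]· rankSign l) ≡ [ does (unique? l) ]· rankSign l
    by-length []       (_ , _ , ())
    by-length (x ∷ xs) (_ , l⁺ , ∑l) = trans
      (∑<-cong n (λ j _ → cong (λ b → [ b ]· rankSign (x ∷ xs))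
                                (isYes≗does (unique? (x ∷ xs) ×-dec (suc (length xs) ≟ suc j)))))
      (∑<-select n (does (unique? (x ∷ xs))) (rankSign (x ∷ xs))
         (ℕₚ.≤-<-trans (ℕ.s≤s⁻¹ (subst (length (x ∷ xs) ≤_) ∑l (length≤sum l⁺))) i<n))

  oddRunCount≡signCount⋆p : ∀ k n → oddRunCount k n ≡ (signCount k ⋆ pℤ) n
  oddRunCount≡signCount⋆p zero n =
    trans (oddRunCount-0 n) (sym (⋆-identityˡ (signCount 0) pℤ signCount-0-0 signCount-0-suc n))
  oddRunCount≡signCount⋆p (suc k) = <-rec _ step
    where
    step : ∀ n → (∀ {m} → m < n → oddRunCount (suc k) m ≡ (signCount (suc k) ⋆ pℤ) m) →
           oddRunCount (suc k) n ≡ (signCount (suc k) ⋆ pℤ) n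
    step n IH with n ℕ.<? suc k
    ... | yes n<k = trans (oddRunCount-vanish n<k) (sym (⋆-vanish (signCount (suc k)) pℤ n
                            (λ j j≤n → signCount-vanish (ℕₚ.≤-<-trans j≤n n<k))))
    ... | no  n≮k with m , refl ← ℕₚ.m≤n⇒∃[o]m+o≡n (ℕₚ.≮⇒≥ n≮k) = begin
      oddRunCount (suc k) (suc k + m)
        ≡⟨ oddRunCount-recurrence k m ⟩
      oddRunCount k m ℤ.- oddRunCount (suc k) m
        ≡⟨ cong₂ ℤ._-_ (oddRunCount≡signCount⋆p k m) (IH (ℕₚ.m<n+m m (s≤s z≤n))) ⟩
      (signCount k ⋆ pℤ) m ℤ.- (signCount (suc k) ⋆ pℤ) m
        ≡⟨ sym (⋆-recurrence (suc k) (signCount (suc k)) (signCount k) pℤ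
                             (λ _ → signCount-vanish) (signCount-recurrence k) m) ⟩
      (signCount (suc k) ⋆ pℤ) (suc k + m) ∎
      where open ≡-Reasoning

  ∑t≡∑oddRunCount : ∀ n → + sum (map t (parts n)) ≡ ∑< n (λ j → oddRunCount (suc j) n)
  ∑t≡∑oddRunCount n = begin
    + sum (map t (parts n))
      ≡⟨ +-sum-map t (parts n) ⟩
    sumBy (λ π → + t π) (parts n)
      ≡⟨ sumBy-cong (parts n) (λ π π∈ → t≡∑oddRun π (isPartition π∈)) ⟩
    sumBy (λ π → ∑< n (λ j → [ oddRun 1 (suc j) π ]· + 1)) (parts n)
      ≡⟨ sumBy-∑< (parts n) n (λ π j → [ oddRun 1 (suc j) π ]· + 1) ⟩
    ∑< n (λ j → oddRunCount (suc j) n) ∎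
    where
    open ≡-Reasoning
    -- The fuel length π + 1 of t and the bound n of the sum both exceed the longest run.
    t≡∑oddRun : ∀ π → IsPartition n π → + t π ≡ ∑< n (λ j → [ oddRun 1 (suc j) π ]· + 1)
    t≡∑oddRun π (_ , _ , ∑π) = begin
      + t π                ≡⟨ chainFrom-∑< fuel 1 π ⟩
      ∑< fuel run          ≡⟨ sym (∑<-truncate {fuel} {fuel + n} run (ℕₚ.m≤m+n fuel n) (beyond ≤fuel)) ⟩
      ∑< (fuel + n) run    ≡⟨ ∑<-truncate {n} {fuel + n} run (ℕₚ.m≤n+m n fuel) (beyond ≤n) ⟩
      ∑< n run             ∎
      where
      fuel : ℕ
      fuel = suc (length π)
      run : ℕ → ℤ
      run j = [ oddRun 1 (suc j) π ]· + 1
      ≤fuel : ∀ {j} → T (oddRun 1 (suc j) π) → suc j ≤ fuel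
      ≤fuel r = ℕₚ.m≤n⇒m≤1+n (oddRun⇒≤length 1 _ π r)
      ≤n : ∀ {j} → T (oddRun 1 (suc j) π) → suc j ≤ n
      ≤n r = subst (_ ≤_) ∑π (∈⇒≤sum (oddRun⇒last∈ 1 _ π r))
      beyond : ∀ {b} → (∀ {j} → T (oddRun 1 (suc j) π) → suc j ≤ b) → ∀ j → b ≤ j → run j ≡ + 0
      beyond bound j b≤j = []·-false (+ 1) (λ r → ℕₚ.<-irrefl refl (ℕₚ.≤-trans (bound r) b≤j))

  ∑signCount⋆p≡∑S·p : ∀ n → ∑< n (λ j → (signCount (suc j) ⋆ pℤ) n)
                          ≡ ∑< n (λ i → S parts (suc i) ℤ.* pℤ (n ∸ suc i))
  ∑signCount⋆p≡∑S·p n = begin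
    ∑< n (λ j → ∑< (suc n) (λ i → signCount (suc j) i ℤ.* pℤ (n ∸ i)))
      ≡⟨ ∑<-comm n (suc n) (λ j i → signCount (suc j) i ℤ.* pℤ (n ∸ i)) ⟩
    ∑< (suc n) (λ i → ∑< n (λ j → signCount (suc j) i ℤ.* pℤ (n ∸ i)))
      ≡⟨ ∑<-cong (suc n) (λ i _ → sym (∑<-*ʳ n (λ j → signCount (suc j) i) (pℤ (n ∸ i)))) ⟩
    ∑< n (λ j → signCount (suc j) 0) ℤ.* pℤ n ℤ.+
    ∑< n (λ i → ∑< n (λ j → signCount (suc j) (suc i)) ℤ.* pℤ (n ∸ suc i))
      ≡⟨ cong₂ ℤ._+_ (cong (ℤ._* pℤ n) (∑<-zero n (λ j _ → signCount-vanish (s≤s z≤n))))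
                     (∑<-cong n (λ i i<n → cong (ℤ._* pℤ (n ∸ suc i)) (sym (S≡∑signCount i i<n)))) ⟩
    + 0 ℤ.+ ∑< n (λ i → S parts (suc i) ℤ.* pℤ (n ∸ suc i))
      ≡⟨ ℤₚ.+-identityˡ _ ⟩
    ∑< n (λ i → S parts (suc i) ℤ.* pℤ (n ∸ suc i)) ∎
    where open ≡-Reasoning

theorem5 : (parts : ℕ → List (List ℕ)) →
           (∀ m → Unique (parts m)) →
           (∀ m xs → (xs ∈ parts m) ⇔ IsPartition m xs) →
           ∀ n → 1 ≤ n →
           + (sum (map t (parts n)))
             ≡ sumℤ (map (λ i → S parts i ℤ.* + (p parts (n ∸ i))) (applyUpTo suc n))
theorem5 parts parts! ∈parts⇔ n _ = begin
  + sum (map t (parts n))                          ≡⟨ ∑t≡∑oddRunCount n ⟩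
  ∑< n (λ j → oddRunCount (suc j) n)               ≡⟨ ∑<-cong n (λ j _ → oddRunCount≡signCount⋆p (suc j) n) ⟩
  ∑< n (λ j → (signCount (suc j) ⋆ pℤ) n)          ≡⟨ ∑signCount⋆p≡∑S·p n ⟩
  ∑< n (λ i → S parts (suc i) ℤ.* pℤ (n ∸ suc i))  ≡⟨ sym (sumBy-applyUpTo (λ i → S parts i ℤ.* pℤ (n ∸ i)) suc n) ⟩
  sumℤ (map (λ i → S parts i ℤ.* + (p parts (n ∸ i))) (applyUpTo suc n)) ∎
  where
  open Counting parts parts! ∈parts⇔
  open ≡-Reasoning
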